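{- Let $u\leq n$, $U=[u]$ and $V=[n]\setminus U$. Let $\mathcal{A}$ be an antichain of subsets of $[n]$ (with respect to inclusion) which in addition satisfies $|A\cap V|=f(|A\cap U|)$ for all $A\in\mathcal{A}$, where $f:\mathbb{N}\to\mathbb{N}$ is some monotone increasing function. Then $$|\mathcal{A}|\leq \binom{u}{\lfloor u/2\rfloor}\binom{n-u}{\lfloor (n-u)/2\rfloor}.$$
   Context: An antichain is a family of pairwise incomparable sets, i.e., no member is a subset of another distinct member. -}

module Defs where

open import Data.Nat using (ℕ; _≤_; _<?_)
open import Data.Fin using (Fin; toℕ)
open import Data.Fin.Subset using (Subset; _⊆_; _∩_; ∣_∣; ∁)
open import Data.Vec using (tabulate)
open import Data.List using (List)
open import Data.List.Membership.Propositional using (_∈_)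
open import Data.List.Relation.Unary.Unique.Propositional using (Unique)
open import Relation.Binary.PropositionalEquality using (_≢_)
open import Relation.Nullary using (¬_)
open import Relation.Nullary.Decidable using (does)

-- U = [u] = {1,…,u}, realised inside Fin n = {0,…,n-1} as the first u elements
Uset : ℕ → (n : ℕ) → Subset n
Uset u n = tabulate (λ (i : Fin n) → does (toℕ i <? u))

Vset : ℕ → (n : ℕ) → Subset n
Vset u n = ∁ (Uset u n)

IsAntichain : {n : ℕ} → List (Subset n) → Set
IsAntichain {n} 𝒜 = Unique 𝒜 × ((A B : Subset n) → A ∈ 𝒜 → B ∈ 𝒜 → A ≢ B → ¬ (A ⊆ B))
  where open import Data.Product using (_×_)

Monotone : (ℕ → ℕ) → Set
Monotone f = ∀ {a b} → a ≤ b → f a ≤ f b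

{-# OPTIONS --safe #-}
module Submission where

-- Bracket matching (Greene–Kleitman) splits the subsets of an m-set into chains: pair each
-- element inside a set with the nearest unpaired element outside it to its right; the sets
-- with the same pairs form a chain, along which only the unpaired positions change, and
-- each chain meets level ⌊m/2⌋ exactly once. Label A ∈ 𝒜 by the middle sets of the chains
-- through A ∩ U and A ∩ V. Two members with the same label have comparable U-parts and
-- comparable V-parts, and as f is monotone both comparisons go the same way, so one member
-- contains the other and they coincide. Hence the label is injective on 𝒜, and there are
-- only C(u,⌊u/2⌋)·C(v,⌊v/2⌋) labels.

open import Defs
open import Data.Empty using (⊥-elim)
open import Level using (Level)
open import Data.Fin using (zero; suc)
open import Data.Fin.Properties using (injective⇒≤)
open import Data.Fin.Subset using (Subset; Side; inside; outside; _∩_; ∣_∣; _⊆_; ⊤; ⊥)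
open import Data.Fin.Subset.Properties
  using (out⊆; in⊆in; drop-∷-⊆; ∩-identityʳ; ∩-zeroʳ; ∣⊥∣≡0)
open import Data.List using (List; []; _∷_; [_]; _++_; length; map; lookup; cartesianProduct)
open import Data.List.Properties using (length-map; length-++)
open import Data.List.Membership.Propositional using (_∈_)
open import Data.List.Membership.Propositional.Properties
  using (∈-lookup; ∈-map⁺; ∈-++⁺ˡ; ∈-++⁺ʳ; ∈-cartesianProduct⁺)
open import Data.List.Membership.Setoid.Properties using (index-injective)
import Data.List.Relation.Unary.All as All
import Data.List.Relation.Unary.Any as Any
open import Data.List.Relation.Unary.Unique.Propositional using (Unique; _∷_)
open import Data.Nat using (ℕ; zero; suc; _+_; _*_; _∸_; _/_; _≤_; _<_; z≤n; s≤s; s≤s⁻¹)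
open import Data.Nat.Combinatorics using (_C_; nCk+nC[k+1]≡[n+1]C[k+1])
open import Data.Nat.DivMod using (m*n/n≡m; +-distrib-/-∣ʳ; m/n≤m)
open import Data.Nat.Divisibility using (n∣m*n)
open import Data.Nat.Properties
  using (≤-trans; m<n⇒0<n; ≤-reflexive; ≤-total; +-suc; +-comm; suc-injective; 0∸n≡0; m∸n≤m;
         m∸[m∸n]≡n; m+[n∸m]≡n; ∸-cancelʳ-≤; +-cancelˡ-≤; module ≤-Reasoning)
open import Data.Product using (_×_; _,_; proj₁; proj₂; uncurry)
open import Data.Sum using (inj₁; inj₂)
open import Data.Vec using (Vec; []; _∷_; take; drop; here)
import Data.Vec.Properties as Vec
import Data.Bool.Properties as Bool
open import Relation.Binary.PropositionalEquality
  using (_≡_; refl; sym; trans; cong; cong₂; subst₂; setoid; module ≡-Reasoning)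
open import Relation.Nullary.Decidable using (decidable-stable)

private
  variable
    a b : Level
    A : Set a
    B : Set b
    m : ℕ

Unique⇒lookup-injective : ∀ {xs : List A} → Unique xs →
                          ∀ {i j} → lookup xs i ≡ lookup xs j → i ≡ j
Unique⇒lookup-injective {xs = _ ∷ _} _          {zero}  {zero}  _  = refl
Unique⇒lookup-injective              (x∉xs ∷ _) {zero}  {suc j} eq =
  ⊥-elim (All.lookup x∉xs (∈-lookup j) eq)
Unique⇒lookup-injective              (x∉xs ∷ _) {suc i} {zero}  eq =
  ⊥-elim (All.lookup x∉xs (∈-lookup i) (sym eq))
Unique⇒lookup-injective              (_ ∷ xs!)  {suc i} {suc j} eq =
  cong suc (Unique⇒lookup-injective xs! eq)

injectiveOn⇒length≤ : ∀ {xs : List A} {ys : List B} (g : A → B) → Unique xs →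
                      (∀ {x y} → x ∈ xs → y ∈ xs → g x ≡ g y → x ≡ y) →
                      (∀ {x} → x ∈ xs → g x ∈ ys) →
                      length xs ≤ length ys
injectiveOn⇒length≤ g xs! g-inj g∈ = injective⇒≤ λ {i} {j} eq →
  Unique⇒lookup-injective xs! (g-inj (∈-lookup i) (∈-lookup j)
    (index-injective (setoid _) (g∈ (∈-lookup i)) (g∈ (∈-lookup j)) eq))

length-cartesianProduct : ∀ (xs : List A) (ys : List B) →
                          length (cartesianProduct xs ys) ≡ length xs * length ys
length-cartesianProduct []       ys = refl
length-cartesianProduct (x ∷ xs) ys = begin
  length (map (x ,_) ys ++ cartesianProduct xs ys)
    ≡⟨ length-++ (map (x ,_) ys) ⟩
  length (map (x ,_) ys) + length (cartesianProduct xs ys)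
    ≡⟨ cong₂ _+_ (length-map (x ,_) ys) (length-cartesianProduct xs ys) ⟩
  length ys + length xs * length ys ∎
  where open ≡-Reasoning

ofSize : ∀ m → ℕ → List (Subset m)
ofSize zero    zero    = [ [] ]
ofSize zero    (suc k) = []
ofSize (suc m) zero    = map (outside ∷_) (ofSize m zero)
ofSize (suc m) (suc k) = map (inside ∷_) (ofSize m k) ++ map (outside ∷_) (ofSize m (suc k))

length-ofSize : ∀ m k → length (ofSize m k) ≡ m C k
length-ofSize zero    zero    = refl
length-ofSize zero    (suc k) = refl
length-ofSize (suc m) zero    = trans (length-map (outside ∷_) (ofSize m zero)) (length-ofSize m zero)
length-ofSize (suc m) (suc k) = begin
  length (map (inside ∷_) (ofSize m k) ++ map (outside ∷_) (ofSize m (suc k)))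
    ≡⟨ length-++ (map (inside ∷_) (ofSize m k)) ⟩
  length (map (inside ∷_) (ofSize m k)) + length (map (outside ∷_) (ofSize m (suc k)))
    ≡⟨ cong₂ _+_ (length-map (inside ∷_) (ofSize m k)) (length-map (outside ∷_) (ofSize m (suc k))) ⟩
  length (ofSize m k) + length (ofSize m (suc k))
    ≡⟨ cong₂ _+_ (length-ofSize m k) (length-ofSize m (suc k)) ⟩
  m C k + m C suc k
    ≡⟨ nCk+nC[k+1]≡[n+1]C[k+1] m k ⟩
  suc m C suc k ∎
  where open ≡-Reasoning

∈-ofSize : ∀ {k} (p : Subset m) → ∣ p ∣ ≡ k → p ∈ ofSize m k
∈-ofSize {k = zero}  []            refl = Any.here refl
∈-ofSize {k = zero}  (outside ∷ p) eq   = ∈-map⁺ (outside ∷_) (∈-ofSize p eq)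
∈-ofSize {k = suc k} (outside ∷ p) eq   = ∈-++⁺ʳ _ (∈-map⁺ (outside ∷_) (∈-ofSize p eq))
∈-ofSize {k = suc k} (inside ∷ p)  eq   = ∈-++⁺ˡ (∈-map⁺ (inside ∷_) (∈-ofSize p (suc-injective eq)))

-- Read inside as "(" and outside as ")": push pairs each "(" with the nearest unpaired ")"
-- to its right, and the number it carries counts the unpaired ")"s. These occupy the first
-- free slots, before the unpaired "("s, which is why fill w k puts outside in the first k.

data Slot : Set where
  pairedIn pairedOut free : Slot

Skeleton : ℕ → Set
Skeleton = Vec Slot

pairFirstFree : Skeleton m → Skeleton m
pairFirstFree []              = []
pairFirstFree (pairedIn ∷ w)  = pairedIn ∷ pairFirstFree w
pairFirstFree (pairedOut ∷ w) = pairedOut ∷ pairFirstFree w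
pairFirstFree (free ∷ w)      = pairedOut ∷ w

push : Side → Skeleton m × ℕ → Skeleton (suc m) × ℕ
push outside (w , a)     = free ∷ w , suc a
push inside  (w , zero)  = free ∷ w , zero
push inside  (w , suc a) = pairedIn ∷ pairFirstFree w , a

parse : Subset m → Skeleton m × ℕ
parse []      = [] , 0
parse (s ∷ p) = push s (parse p)

skeleton : Subset m → Skeleton m
skeleton p = proj₁ (parse p)

fill : Skeleton m → ℕ → Subset m
fill []              k       = []
fill (pairedIn ∷ w)  k       = inside ∷ fill w k
fill (pairedOut ∷ w) k       = outside ∷ fill w k
fill (free ∷ w)      zero    = inside ∷ fill w zero
fill (free ∷ w)      (suc k) = outside ∷ fill w k

#free #pairedIn : Skeleton m → ℕ
#free []              = 0
#free (free ∷ w)      = suc (#free w)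
#free (pairedIn ∷ w)  = #free w
#free (pairedOut ∷ w) = #free w
#pairedIn []              = 0
#pairedIn (pairedIn ∷ w)  = suc (#pairedIn w)
#pairedIn (pairedOut ∷ w) = #pairedIn w
#pairedIn (free ∷ w)      = #pairedIn w

fill-pairFirstFree : ∀ (w : Skeleton m) k → fill (pairFirstFree w) k ≡ fill w (suc k)
fill-pairFirstFree []              k = refl
fill-pairFirstFree (pairedIn ∷ w)  k = cong (inside ∷_) (fill-pairFirstFree w k)
fill-pairFirstFree (pairedOut ∷ w) k = cong (outside ∷_) (fill-pairFirstFree w k)
fill-pairFirstFree (free ∷ w)      k = refl

#free-pairFirstFree : ∀ (w : Skeleton m) → 0 < #free w → suc (#free (pairFirstFree w)) ≡ #free w
#free-pairFirstFree (pairedIn ∷ w)  0<#free = #free-pairFirstFree w 0<#free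
#free-pairFirstFree (pairedOut ∷ w) 0<#free = #free-pairFirstFree w 0<#free
#free-pairFirstFree (free ∷ w)      _       = refl

#pairedIn-pairFirstFree : ∀ (w : Skeleton m) → #pairedIn (pairFirstFree w) ≡ #pairedIn w
#pairedIn-pairFirstFree []              = refl
#pairedIn-pairFirstFree (pairedIn ∷ w)  = cong suc (#pairedIn-pairFirstFree w)
#pairedIn-pairFirstFree (pairedOut ∷ w) = #pairedIn-pairFirstFree w
#pairedIn-pairFirstFree (free ∷ w)      = refl

fill-push : ∀ s (st : Skeleton m × ℕ) → uncurry fill (push s st) ≡ s ∷ uncurry fill st
fill-push outside (w , a)     = refl
fill-push inside  (w , zero)  = refl
fill-push inside  (w , suc a) = cong (inside ∷_) (fill-pairFirstFree w a)

fill-parse : ∀ (p : Subset m) → uncurry fill (parse p) ≡ p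
fill-parse []      = refl
fill-parse (s ∷ p) = trans (fill-push s (parse p)) (cong (s ∷_) (fill-parse p))

Valid : Skeleton m × ℕ → Set
Valid (w , a) = a ≤ #free w

push-valid : ∀ s {st : Skeleton m × ℕ} → Valid st → Valid (push s st)
push-valid outside {w , a}     a≤#free  = s≤s a≤#free
push-valid inside  {w , zero}  _        = z≤n
push-valid inside  {w , suc a} a<#free  =
  s≤s⁻¹ (≤-trans a<#free (≤-reflexive (sym (#free-pairFirstFree w (m<n⇒0<n a<#free)))))

parse-valid : ∀ (p : Subset m) → Valid (parse p)
parse-valid []      = z≤n
parse-valid (s ∷ p) = push-valid s (parse-valid p)

Balanced : Skeleton m → Set
Balanced {m} w = #free w + #pairedIn w * 2 ≡ m

push-balanced : ∀ s {st : Skeleton m × ℕ} → Valid st →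
                Balanced (proj₁ st) → Balanced (proj₁ (push s st))
push-balanced outside {w , a}     _       bal = cong suc bal
push-balanced inside  {w , zero}  _       bal = cong suc bal
push-balanced inside  {w , suc a} a<#free bal = begin
  #free (pairFirstFree w) + suc (#pairedIn (pairFirstFree w)) * 2
    ≡⟨ cong (λ k → #free (pairFirstFree w) + suc k * 2) (#pairedIn-pairFirstFree w) ⟩
  #free (pairFirstFree w) + suc (suc (#pairedIn w * 2))
    ≡⟨ +-suc _ _ ⟩
  suc (#free (pairFirstFree w)) + suc (#pairedIn w * 2)
    ≡⟨ cong (_+ suc (#pairedIn w * 2)) (#free-pairFirstFree w (m<n⇒0<n a<#free)) ⟩
  #free w + suc (#pairedIn w * 2)
    ≡⟨ +-suc _ _ ⟩
  suc (#free w + #pairedIn w * 2)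
    ≡⟨ cong suc bal ⟩
  suc _ ∎
  where open ≡-Reasoning

skeleton-balanced : ∀ (p : Subset m) → Balanced (skeleton p)
skeleton-balanced []      = refl
skeleton-balanced (s ∷ p) = push-balanced s (parse-valid p) (skeleton-balanced p)

Consistent : Skeleton m → Set
Consistent w = ∀ {k} → k ≤ #free w → parse (fill w k) ≡ (w , k)

free-consistent : ∀ {w : Skeleton m} → Consistent w → Consistent (free ∷ w)
free-consistent con {zero}  _         = cong (push inside) (con z≤n)
free-consistent con {suc k} (s≤s k≤)  = cong (push outside) (con k≤)

pairFirstFree-consistent : ∀ {w : Skeleton m} → 0 < #free w → Consistent w →
                           Consistent (pairedIn ∷ pairFirstFree w)
pairFirstFree-consistent {w = w} 0<#free con {k} k≤ = begin
  push inside (parse (fill (pairFirstFree w) k))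
    ≡⟨ cong (λ p → push inside (parse p)) (fill-pairFirstFree w k) ⟩
  push inside (parse (fill w (suc k)))
    ≡⟨ cong (push inside) (con (≤-trans (s≤s k≤) (≤-reflexive (#free-pairFirstFree w 0<#free)))) ⟩
  push inside (w , suc k) ∎
  where open ≡-Reasoning

push-consistent : ∀ s {st : Skeleton m × ℕ} → Valid st →
                  Consistent (proj₁ st) → Consistent (proj₁ (push s st))
push-consistent outside {w , a}     _       = free-consistent
push-consistent inside  {w , zero}  _       = free-consistent
push-consistent inside  {w , suc a} a<#free = pairFirstFree-consistent (m<n⇒0<n a<#free)

skeleton-consistent : ∀ (p : Subset m) → Consistent (skeleton p)
skeleton-consistent []      z≤n = refl
skeleton-consistent (s ∷ p) = push-consistent s (parse-valid p) (skeleton-consistent p)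

∣fill∣ : ∀ (w : Skeleton m) k → ∣ fill w k ∣ ≡ #pairedIn w + (#free w ∸ k)
∣fill∣ []              k       = sym (0∸n≡0 k)
∣fill∣ (pairedIn ∷ w)  k       = cong suc (∣fill∣ w k)
∣fill∣ (pairedOut ∷ w) k       = ∣fill∣ w k
∣fill∣ (free ∷ w)      zero    = trans (cong suc (∣fill∣ w zero)) (sym (+-suc _ _))
∣fill∣ (free ∷ w)      (suc k) = ∣fill∣ w k

fill-antitone : ∀ (w : Skeleton m) {k l} → k ≤ l → fill w l ⊆ fill w k
fill-antitone []              _         = λ ()
fill-antitone (pairedIn ∷ w)  k≤l       = in⊆in (fill-antitone w k≤l)
fill-antitone (pairedOut ∷ w) k≤l       = out⊆ (fill-antitone w k≤l)
fill-antitone (free ∷ w) {l = zero}  z≤n       = in⊆in (fill-antitone w z≤n)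
fill-antitone (free ∷ w) {l = suc l} z≤n       = out⊆ (fill-antitone w z≤n)
fill-antitone (free ∷ w)             (s≤s k≤l) = out⊆ (fill-antitone w k≤l)

fill-⊆ : ∀ (w : Skeleton m) {k l} → l ≤ #free w → ∣ fill w k ∣ ≤ ∣ fill w l ∣ → fill w k ⊆ fill w l
fill-⊆ w {k} {l} l≤#free size≤ = fill-antitone w (∸-cancelʳ-≤ l≤#free
  (+-cancelˡ-≤ (#pairedIn w) _ _ (subst₂ _≤_ (∣fill∣ w k) (∣fill∣ w l) size≤)))

same-skeleton-⊆ : ∀ {p q : Subset m} → skeleton p ≡ skeleton q → ∣ p ∣ ≤ ∣ q ∣ → p ⊆ q
same-skeleton-⊆ {p = p} {q} eq size≤
  with parse p | fill-parse p | parse q | fill-parse q | parse-valid q | eq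
... | w , _ | refl | .w , _ | refl | b≤#free | refl = fill-⊆ w b≤#free size≤

middle : Subset m → Subset m
middle p = fill w (#free w ∸ #free w / 2)
  where w = skeleton p

skeleton-middle : ∀ (p : Subset m) → skeleton (middle p) ≡ skeleton p
skeleton-middle p = cong proj₁ (skeleton-consistent p (m∸n≤m (#free w) (#free w / 2)))
  where w = skeleton p

∣middle∣ : ∀ (p : Subset m) → ∣ middle p ∣ ≡ m / 2
∣middle∣ {m} p = begin
  ∣ fill w (#free w ∸ #free w / 2) ∣
    ≡⟨ ∣fill∣ w _ ⟩
  #pairedIn w + (#free w ∸ (#free w ∸ #free w / 2))
    ≡⟨ cong (#pairedIn w +_) (m∸[m∸n]≡n (m/n≤m (#free w) 2)) ⟩
  #pairedIn w + #free w / 2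
    ≡⟨ +-comm (#pairedIn w) _ ⟩
  #free w / 2 + #pairedIn w
    ≡⟨ cong (#free w / 2 +_) (m*n/n≡m (#pairedIn w) 2) ⟨
  #free w / 2 + #pairedIn w * 2 / 2
    ≡⟨ +-distrib-/-∣ʳ (#free w) (n∣m*n (#pairedIn w)) ⟨
  (#free w + #pairedIn w * 2) / 2
    ≡⟨ cong (_/ 2) (skeleton-balanced p) ⟩
  m / 2 ∎
  where
  open ≡-Reasoning
  w = skeleton p

middle-⊆ : ∀ {p q : Subset m} → middle p ≡ middle q → ∣ p ∣ ≤ ∣ q ∣ → p ⊆ q
middle-⊆ {p = p} {q} eq = same-skeleton-⊆ (begin
  skeleton p          ≡⟨ skeleton-middle p ⟨
  skeleton (middle p) ≡⟨ cong skeleton eq ⟩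
  skeleton (middle q) ≡⟨ skeleton-middle q ⟩
  skeleton q          ∎)
  where open ≡-Reasoning

Uset-zero : ∀ n → Uset 0 n ≡ ⊥
Uset-zero zero    = refl
Uset-zero (suc n) = cong (outside ∷_) (Uset-zero n)

Vset-zero : ∀ n → Vset 0 n ≡ ⊤
Vset-zero zero    = refl
Vset-zero (suc n) = cong (inside ∷_) (Vset-zero n)

∣∩Uset∣ : ∀ u {v} (p : Subset (u + v)) → ∣ p ∩ Uset u (u + v) ∣ ≡ ∣ take u p ∣
∣∩Uset∣ zero    {v} p = begin
  ∣ p ∩ Uset 0 v ∣ ≡⟨ cong (λ U → ∣ p ∩ U ∣) (Uset-zero v) ⟩
  ∣ p ∩ ⊥ ∣       ≡⟨ cong ∣_∣ (∩-zeroʳ p) ⟩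
  ∣ ⊥ {v} ∣       ≡⟨ ∣⊥∣≡0 v ⟩
  0               ∎
  where open ≡-Reasoning
∣∩Uset∣ (suc u) (inside  ∷ p) = cong suc (∣∩Uset∣ u p)
∣∩Uset∣ (suc u) (outside ∷ p) = ∣∩Uset∣ u p

∣∩Vset∣ : ∀ u {v} (p : Subset (u + v)) → ∣ p ∩ Vset u (u + v) ∣ ≡ ∣ drop u p ∣
∣∩Vset∣ zero    {v} p = cong ∣_∣ (trans (cong (p ∩_) (Vset-zero v)) (∩-identityʳ p))
∣∩Vset∣ (suc u) (inside  ∷ p) = ∣∩Vset∣ u p
∣∩Vset∣ (suc u) (outside ∷ p) = ∣∩Vset∣ u p

take-drop-⊆ : ∀ u {v} {p q : Subset (u + v)} → take u p ⊆ take u q → drop u p ⊆ drop u q → p ⊆ q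
take-drop-⊆ zero    _ drop⊆ = drop⊆
take-drop-⊆ (suc u) {p = outside ∷ p} {_ ∷ q}       take⊆ drop⊆ =
  out⊆ (take-drop-⊆ u (drop-∷-⊆ take⊆) drop⊆)
take-drop-⊆ (suc u) {p = inside  ∷ p} {inside ∷ q}  take⊆ drop⊆ =
  in⊆in (take-drop-⊆ u (drop-∷-⊆ take⊆) drop⊆)
take-drop-⊆ (suc u) {p = inside  ∷ p} {outside ∷ q} take⊆ drop⊆ with take⊆ here
... | ()

antichain-⊆⇒≡ : ∀ {𝒜 : List (Subset m)} → IsAntichain 𝒜 →
                ∀ {A B} → A ∈ 𝒜 → B ∈ 𝒜 → A ⊆ B → A ≡ B
antichain-⊆⇒≡ (_ , incomparable) {A} {B} A∈𝒜 B∈𝒜 A⊆B =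
  decidable-stable (Vec.≡-dec Bool._≟_ A B) (λ A≢B → incomparable A B A∈𝒜 B∈𝒜 A≢B A⊆B)

antichain-bound : ∀ u v (f : ℕ → ℕ) → Monotone f →
  (𝒜 : List (Subset (u + v))) → IsAntichain 𝒜 →
  (∀ A → A ∈ 𝒜 → ∣ A ∩ Vset u (u + v) ∣ ≡ f ∣ A ∩ Uset u (u + v) ∣) →
  length 𝒜 ≤ (u C (u / 2)) * (v C (v / 2))
antichain-bound u v f f-mono 𝒜 antichain sizes = begin
  length 𝒜
    ≤⟨ injectiveOn⇒length≤ label (proj₁ antichain) label-injective label∈ ⟩
  length (cartesianProduct (ofSize u (u / 2)) (ofSize v (v / 2)))
    ≡⟨ length-cartesianProduct (ofSize u (u / 2)) (ofSize v (v / 2)) ⟩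
  length (ofSize u (u / 2)) * length (ofSize v (v / 2))
    ≡⟨ cong₂ _*_ (length-ofSize u (u / 2)) (length-ofSize v (v / 2)) ⟩
  (u C (u / 2)) * (v C (v / 2)) ∎
  where
  open ≤-Reasoning

  label : Subset (u + v) → Subset u × Subset v
  label A = middle (take u A) , middle (drop u A)

  label∈ : ∀ {A} → A ∈ 𝒜 → label A ∈ cartesianProduct (ofSize u (u / 2)) (ofSize v (v / 2))
  label∈ {A} _ =
    ∈-cartesianProduct⁺ (∈-ofSize _ (∣middle∣ (take u A))) (∈-ofSize _ (∣middle∣ (drop u A)))

  ∣drop∣ : ∀ {A} → A ∈ 𝒜 → ∣ drop u A ∣ ≡ f ∣ take u A ∣
  ∣drop∣ {A} A∈𝒜 = begin-equality
    ∣ drop u A ∣              ≡⟨ ∣∩Vset∣ u A ⟨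
    ∣ A ∩ Vset u (u + v) ∣    ≡⟨ sizes A A∈𝒜 ⟩
    f ∣ A ∩ Uset u (u + v) ∣  ≡⟨ cong f (∣∩Uset∣ u A) ⟩
    f ∣ take u A ∣            ∎

  same-label-⊆ : ∀ {A B} → A ∈ 𝒜 → B ∈ 𝒜 → label A ≡ label B →
                 ∣ take u A ∣ ≤ ∣ take u B ∣ → A ⊆ B
  same-label-⊆ A∈𝒜 B∈𝒜 eq ∣take∣≤ = take-drop-⊆ u (middle-⊆ (cong proj₁ eq) ∣take∣≤)
    (middle-⊆ (cong proj₂ eq) (subst₂ _≤_ (sym (∣drop∣ A∈𝒜)) (sym (∣drop∣ B∈𝒜)) (f-mono ∣take∣≤)))

  label-injective : ∀ {A B} → A ∈ 𝒜 → B ∈ 𝒜 → label A ≡ label B → A ≡ B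
  label-injective {A} {B} A∈𝒜 B∈𝒜 eq with ≤-total ∣ take u A ∣ ∣ take u B ∣
  ... | inj₁ ∣take∣≤ = antichain-⊆⇒≡ antichain A∈𝒜 B∈𝒜 (same-label-⊆ A∈𝒜 B∈𝒜 eq ∣take∣≤)
  ... | inj₂ ∣take∣≥ = sym (antichain-⊆⇒≡ antichain B∈𝒜 A∈𝒜 (same-label-⊆ B∈𝒜 A∈𝒜 (sym eq) ∣take∣≥))

lemma2p3 : (n u : ℕ) → u ≤ n → (f : ℕ → ℕ) → Monotone f →
    (𝒜 : List (Subset n)) → IsAntichain 𝒜 →
    (∀ A → A ∈ 𝒜 → ∣ A ∩ Vset u n ∣ ≡ f ∣ A ∩ Uset u n ∣) →
    length 𝒜 ≤ (u C (u / 2)) * ((n ∸ u) C ((n ∸ u) / 2))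
lemma2p3 n u u≤n with n ∸ u | m+[n∸m]≡n u≤n
... | v | refl = antichain-bound u v
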